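{- For every $n\ge1$, the greedy from the bottom (GFB) tree $T^{gfb}_n$ with $n$ leaves has minimal Colless index, i.e. $\mathcal{C}(T^{gfb}_n)=c_n$, where $c_n$ is the minimum of the Colless index over all rooted binary trees with $n$ leaves.
   Context: A rooted binary tree with $n\ge2$ leaves is a rooted tree in which the root has degree 2 and every other internal vertex has degree 3 (each internal vertex has exactly two children); the single vertex is the rooted binary tree with one leaf. For a vertex $v$, $\kappa_T(v)$ is the number of leaves descending from $v$ ($1$ if $v$ is a leaf). For an internal vertex $v$ with children $v_1,v_2$, $bal_T(v)=|\kappa_T(v_1)-\kappa_T(v_2)|$, and the Colless index is $\mathcal{C}(T)=\sum_{v\text{ internal}} bal_T(v)$. The GFB tree $T^{gfb}_n$ is the output (up to isomorphism) of the following algorithm: start with a set of $n$ trees each consisting of a single vertex; while the set contains more than one tree, remove a tree $u$ of minimum number of leaves, then remove a tree $v$ of minimum number of leaves among the remaining trees, and add to the set the tree with a new root whose two children are the roots of $u$ and $v$; output the single remaining tree. For $n=1$ the output is a single vertex. -}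

module Defs where

open import Data.Nat using (ℕ; zero; suc; _+_; _≤_; _∸_)
open import Data.List using (List; []; _∷_; replicate)
open import Data.List.Relation.Unary.All using (All)
open import Data.List.Relation.Binary.Permutation.Propositional using (_↭_)
open import Relation.Binary.PropositionalEquality using (_≡_)
open import Data.Product using (_×_)

data Tree : Set where
  leaf : Tree
  node : Tree → Tree → Tree

leaves : Tree → ℕ
leaves leaf = 1
leaves (node l r) = leaves l + leaves r

absDiff : ℕ → ℕ → ℕ
absDiff a b = (a ∸ b) + (b ∸ a)

colless : Tree → ℕ
colless leaf = 0
colless (node l r) = absDiff (leaves l) (leaves r) + colless l + colless r

-- One step of the GFB algorithm on the current collection (a list up to permutation):
-- remove a tree u of minimum leaf number, then a tree v of minimum leaf number among
-- the remaining ones, and add the tree with a new root whose children are u and v.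
data GFBStep : List Tree → List Tree → Set where
  step : ∀ {xs} u v rest →
         xs ↭ (u ∷ v ∷ rest) →
         All (λ w → leaves u ≤ leaves w) (v ∷ rest) →
         All (λ w → leaves v ≤ leaves w) rest →
         GFBStep xs (node u v ∷ rest)

data GFBRun : List Tree → Tree → Set where
  done : ∀ t → GFBRun (t ∷ []) t
  more : ∀ {xs ys t} → GFBStep xs ys → GFBRun ys t → GFBRun xs t

-- t is a possible output of the GFB algorithm started from n single vertices
-- (any tie-breaking choice).
GFBOutput : ℕ → Tree → Set
GFBOutput n t = GFBRun (replicate n leaf) t

HasMinimalColless : ℕ → Tree → Set
HasMinimalColless n t = (leaves t ≡ n) × (∀ t′ → leaves t′ ≡ n → colless t ≤ colless t′)

-- Write c n for the Colless index of the maximally balanced tree with n leaves, so that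
-- c n = c ⌈n/2⌉ + c ⌊n/2⌋ + (n mod 2). Pairing the halves of a and b according to parity shows
-- c (a + b) ≤ c a + c b + |a − b|, hence c (leaves t) ≤ colless t for every tree t.
-- Conversely c a + c b + |a − b| ≤ c (a + b) as soon as a ≤ 2b, b ≤ 2a and one of a, b is a
-- power of two. Throughout the GFB algorithm any two trees of the collection have sizes related
-- in this way and every tree t has colless t ≤ c (leaves t); a merge step preserves both facts,
-- so the output tree attains the minimum c n.
module Submission where

open import Defs
open import Data.Nat using (ℕ; zero; suc; _+_; _∸_; _≤_; _<_; _>_; _≥_; z≤n; s≤s; z<s; s<s; s≤s⁻¹;
  NonZero; >-nonZero; ⌊_/2⌋; ⌈_/2⌉; ∣_-_∣)
open import Data.Nat.Properties
open import Data.Nat.ListAction using (sum)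
open import Data.Nat.ListAction.Properties using (sum-↭)
open import Data.Nat.Tactic.RingSolver using (solve-∀)
open import Data.Product using (Σ; _×_; _,_; ∃₂)
open import Data.Sum using (_⊎_; inj₁; inj₂) renaming (swap to ⊎-swap)
open import Data.List using (List; []; _∷_; replicate; length; map)
open import Data.List.Properties using (length-replicate)
open import Data.List.Relation.Unary.All as All using (All; []; _∷_)
open import Data.List.Relation.Unary.All.Properties using (replicate⁺)
open import Data.List.Relation.Unary.AllPairs using (AllPairs; []; _∷_)
open import Data.List.Relation.Binary.Permutation.Propositional
  using (_↭_; ↭-refl; ↭-trans; prep; swap; ↭⇒↭ₛ)
open import Data.List.Relation.Binary.Permutation.Propositional.Properties
  using (All-resp-↭; map⁺; ↭-length)
open import Function using (_∘_)
open import Relation.Nullary using (contradiction; yes; no)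
open import Relation.Binary.PropositionalEquality
  using (_≡_; refl; sym; trans; cong; cong₂; subst; subst₂; setoid; resp₂; module ≡-Reasoning)
open import Data.List.Relation.Binary.Permutation.Setoid.Properties (setoid Tree)
  using (AllPairs-resp-↭)

-- The Colless index of the maximally balanced tree with n leaves. The fuel only ensures
-- termination: any fuel ≥ n gives the same value (minCollessWithin-fuel).
minCollessWithin : ℕ → ℕ → ℕ
minCollessWithin _          0                = 0
minCollessWithin _          1                = 0
minCollessWithin zero       _                = 0
minCollessWithin (suc fuel) n@(suc (suc _)) =
  minCollessWithin fuel ⌈ n /2⌉ + minCollessWithin fuel ⌊ n /2⌋ + (⌈ n /2⌉ ∸ ⌊ n /2⌋)

minColless : ℕ → ℕ
minColless n = minCollessWithin n n

minCollessWithin-fuel : ∀ {f g} n → n ≤ f → n ≤ g → minCollessWithin f n ≡ minCollessWithin g n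
minCollessWithin-fuel 0 _ _ = refl
minCollessWithin-fuel 1 _ _ = refl
minCollessWithin-fuel {suc f} {suc g} n@(suc (suc m)) n≤1+f n≤1+g =
  cong₂ (λ x y → x + y + (⌈ n /2⌉ ∸ ⌊ n /2⌋))
    (minCollessWithin-fuel _ (⌈n/2⌉≤ n≤1+f) (⌈n/2⌉≤ n≤1+g))
    (minCollessWithin-fuel _ (⌊n/2⌋≤ n≤1+f) (⌊n/2⌋≤ n≤1+g))
  where
  ⌈n/2⌉≤ : ∀ {h} → n ≤ suc h → ⌈ n /2⌉ ≤ h
  ⌈n/2⌉≤ n≤1+h = s≤s⁻¹ (≤-trans (⌈n/2⌉<n m) n≤1+h)
  ⌊n/2⌋≤ : ∀ {h} → n ≤ suc h → ⌊ n /2⌋ ≤ h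
  ⌊n/2⌋≤ n≤1+h = ≤-trans (⌊n/2⌋≤⌈n/2⌉ n) (⌈n/2⌉≤ n≤1+h)

minColless-halves : ∀ n → 2 ≤ n →
  minColless n ≡ minColless ⌈ n /2⌉ + minColless ⌊ n /2⌋ + (⌈ n /2⌉ ∸ ⌊ n /2⌋)
minColless-halves n@(suc (suc m)) (s≤s (s≤s _)) =
  cong₂ (λ x y → x + y + (⌈ n /2⌉ ∸ ⌊ n /2⌋))
    (minCollessWithin-fuel _ (s≤s⁻¹ (⌈n/2⌉<n m)) ≤-refl)
    (minCollessWithin-fuel _ (≤-trans (⌊n/2⌋≤⌈n/2⌉ n) (s≤s⁻¹ (⌈n/2⌉<n m))) ≤-refl)

minColless-double : ∀ m → minColless (m + m) ≡ minColless m + minColless m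
minColless-double zero      = refl
minColless-double m@(suc _) = begin
  c (m + m)                                               ≡⟨ minColless-halves (m + m) 2≤m+m ⟩
  c ⌈ m + m /2⌉ + c ⌊ m + m /2⌋ + (⌈ m + m /2⌉ ∸ ⌊ m + m /2⌋)
    ≡⟨ cong₂ (λ x y → c x + c y + (x ∸ y)) (n≡⌈n+n/2⌉ m) (n≡⌊n+n/2⌋ m) ⟨
  c m + c m + (m ∸ m)                                     ≡⟨ cong (c m + c m +_) (n∸n≡0 m) ⟩
  c m + c m + 0                                           ≡⟨ +-identityʳ (c m + c m) ⟩
  c m + c m                                               ∎
  where
  open ≡-Reasoning
  c = minColless
  2≤m+m : 2 ≤ m + m
  2≤m+m = +-mono-≤ {1} {m} {1} {m} (s≤s z≤n) (s≤s z≤n)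

minColless-odd : ∀ m → .{{NonZero m}} → minColless (suc (m + m)) ≡ minColless (suc m) + minColless m + 1
minColless-odd m@(suc _) = begin
  c n                                                     ≡⟨ minColless-halves n (s≤s (s≤s z≤n)) ⟩
  c ⌈ n /2⌉ + c ⌊ n /2⌋ + (⌈ n /2⌉ ∸ ⌊ n /2⌋)
    ≡⟨ cong₂ (λ x y → c x + c y + (x ∸ y)) (cong suc (n≡⌊n+n/2⌋ m)) (n≡⌈n+n/2⌉ m) ⟨
  c (suc m) + c m + (suc m ∸ m)                           ≡⟨ cong (c (suc m) + c m +_) (m+n∸n≡m 1 m) ⟩
  c (suc m) + c m + 1                                     ∎
  where
  open ≡-Reasoning
  c = minColless
  n = suc (m + m)

minColless-odd-≤ : ∀ m → minColless (suc (m + m)) ≤ minColless (suc m) + minColless m + 1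
minColless-odd-≤ zero      = z≤n
minColless-odd-≤ m@(suc _) = ≤-reflexive (minColless-odd m)

absDiff≡∣-∣ : ∀ m n → absDiff m n ≡ ∣ m - n ∣
absDiff≡∣-∣ zero    zero    = refl
absDiff≡∣-∣ zero    (suc n) = refl
absDiff≡∣-∣ (suc m) zero    = +-identityʳ (suc m)
absDiff≡∣-∣ (suc m) (suc n) = absDiff≡∣-∣ m n

∣m+m-n+n∣≡∣m-n∣+∣m-n∣ : ∀ m n → ∣ m + m - n + n ∣ ≡ ∣ m - n ∣ + ∣ m - n ∣
∣m+m-n+n∣≡∣m-n∣+∣m-n∣ zero    n       = refl
∣m+m-n+n∣≡∣m-n∣+∣m-n∣ (suc m) zero    = refl
∣m+m-n+n∣≡∣m-n∣+∣m-n∣ (suc m) (suc n)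
  rewrite +-suc m m | +-suc n n = ∣m+m-n+n∣≡∣m-n∣+∣m-n∣ m n

∣m-1+n∣+∣m-n∣≡∣m+m-1+[n+n]∣ : ∀ m n → ∣ m - suc n ∣ + ∣ m - n ∣ ≡ ∣ m + m - suc (n + n) ∣
∣m-1+n∣+∣m-n∣≡∣m+m-1+[n+n]∣ zero    n       = refl
∣m-1+n∣+∣m-n∣≡∣m+m-1+[n+n]∣ (suc m) zero    = 
  trans (cong (_+ suc m) (∣-∣-identityʳ m)) (sym (∣-∣-identityʳ (m + suc m)))
∣m-1+n∣+∣m-n∣≡∣m+m-1+[n+n]∣ (suc m) (suc n)
  rewrite +-suc m m | +-suc n n = ∣m-1+n∣+∣m-n∣≡∣m+m-1+[n+n]∣ m n

∣1+m-n∣≤1+∣m-n∣ : ∀ m n → ∣ suc m - n ∣ ≤ suc ∣ m - n ∣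
∣1+m-n∣≤1+∣m-n∣ m n = ≤-trans (∣-∣-triangle (suc m) m n) (≤-reflexive (cong (_+ ∣ m - n ∣) ∣1+m-m∣≡1))
  where
  ∣1+m-m∣≡1 : ∣ suc m - m ∣ ≡ 1
  ∣1+m-m∣≡1 = trans (m≤n⇒∣n-m∣≡n∸m (n≤1+n m)) (m+n∸n≡m 1 m)

∣m-1+n∣≤1+∣m-n∣ : ∀ m n → ∣ m - suc n ∣ ≤ suc ∣ m - n ∣
∣m-1+n∣≤1+∣m-n∣ m n =
  subst₂ _≤_ (∣-∣-comm (suc n) m) (cong suc (∣-∣-comm n m)) (∣1+m-n∣≤1+∣m-n∣ n m)

m+m≤1+[n+n]⇒m≤n : ∀ {m n} → m + m ≤ suc (n + n) → m ≤ n
m+m≤1+[n+n]⇒m≤n {m} {n} le = subst₂ _≤_ (sym (n≡⌊n+n/2⌋ m)) (sym (n≡⌈n+n/2⌉ n)) (⌊n/2⌋-mono le)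

m+m≤n+n⇒m≤n : ∀ {m n} → m + m ≤ n + n → m ≤ n
m+m≤n+n⇒m≤n le = m+m≤1+[n+n]⇒m≤n (m≤n⇒m≤1+n le)

1+[m+m]≤n+n⇒m<n : ∀ {m n} → suc (m + m) ≤ n + n → m < n
1+[m+m]≤n+n⇒m<n {m} {n} le = subst₂ _≤_ (cong suc (sym (n≡⌊n+n/2⌋ m))) (sym (n≡⌈n+n/2⌉ n)) (⌈n/2⌉-mono le)

data Parity : ℕ → Set where
  even : ∀ k → Parity (k + k)
  odd  : ∀ k → Parity (suc (k + k))

parity : ∀ n → Parity n
parity zero = even 0
parity (suc n) with parity n
... | even k = odd k
... | odd k  = subst Parity (cong suc (+-suc k k)) (even (suc k))

SplitBound : ℕ → ℕ → Set
SplitBound m n = minColless (m + n) ≤ minColless m + minColless n + ∣ m - n ∣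

splitBound-sym : ∀ m n → SplitBound n m → SplitBound m n
splitBound-sym m n = subst₂ _≤_ (cong minColless (+-comm n m))
  (cong₂ _+_ (+-comm (minColless n) (minColless m)) (∣-∣-comm n m))

splitBound-zeroˡ : ∀ n → SplitBound 0 n
splitBound-zeroˡ n = m≤m+n (minColless n) n

splitBound-double : ∀ m n → SplitBound m n → SplitBound (m + m) (n + n)
splitBound-double m n ih = begin
  c ((m + m) + (n + n))            ≡⟨ cong c (interchange m n) ⟩
  c ((m + n) + (m + n))            ≡⟨ minColless-double (m + n) ⟩
  c (m + n) + c (m + n)            ≤⟨ +-mono-≤ ih ih ⟩
  (c m + c n + d) + (c m + c n + d) ≡⟨ interchange₃ (c m) (c n) d ⟩
  (c m + c m) + (c n + c n) + (d + d)
    ≡⟨ cong₂ _+_ (cong₂ _+_ (minColless-double m) (minColless-double n)) (∣m+m-n+n∣≡∣m-n∣+∣m-n∣ m n) ⟨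
  c (m + m) + c (n + n) + ∣ m + m - n + n ∣ ∎
  where
  open ≤-Reasoning
  c = minColless
  d = ∣ m - n ∣
  interchange : ∀ x y → (x + x) + (y + y) ≡ (x + y) + (x + y)
  interchange = solve-∀
  interchange₃ : ∀ x y z → (x + y + z) + (x + y + z) ≡ (x + x) + (y + y) + (z + z)
  interchange₃ = solve-∀

splitBound-odd : ∀ m n → .{{NonZero m}} → .{{NonZero n}} →
  SplitBound (suc m) n → SplitBound m (suc n) → SplitBound (suc (m + m)) (suc (n + n))
splitBound-odd m n ih₁ ih₂ = begin
  c (suc (m + m) + suc (n + n))                           ≡⟨ cong c (interchange m n) ⟩
  c (suc (m + n) + suc (m + n))                           ≡⟨ minColless-double (suc (m + n)) ⟩
  c (suc (m + n)) + c (suc (m + n))                       ≡⟨ cong (λ k → c (suc m + n) + c k) (+-suc m n) ⟨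
  c (suc m + n) + c (m + suc n)                           ≤⟨ +-mono-≤ ih₁ ih₂ ⟩
  (c (suc m) + c n + ∣ suc m - n ∣) + (c m + c (suc n) + ∣ m - suc n ∣)
    ≤⟨ +-mono-≤ (+-monoʳ-≤ (c (suc m) + c n) (∣1+m-n∣≤1+∣m-n∣ m n))
                (+-monoʳ-≤ (c m + c (suc n)) (∣m-1+n∣≤1+∣m-n∣ m n)) ⟩
  (c (suc m) + c n + suc d) + (c m + c (suc n) + suc d)  ≡⟨ rearrange (c (suc m)) (c m) (c (suc n)) (c n) d ⟩
  (c (suc m) + c m + 1) + (c (suc n) + c n + 1) + (d + d)
    ≡⟨ cong₂ _+_ (cong₂ _+_ (minColless-odd m) (minColless-odd n)) (∣m+m-n+n∣≡∣m-n∣+∣m-n∣ m n) ⟨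
  c (suc (m + m)) + c (suc (n + n)) + ∣ m + m - n + n ∣    ∎
  where
  open ≤-Reasoning
  c = minColless
  d = ∣ m - n ∣
  interchange : ∀ x y → suc (x + x) + suc (y + y) ≡ suc (x + y) + suc (x + y)
  interchange = solve-∀
  rearrange : ∀ a b p q z → (a + q + suc z) + (b + p + suc z) ≡ (a + b + 1) + (p + q + 1) + (z + z)
  rearrange = solve-∀

splitBound-double-odd : ∀ m n → .{{NonZero n}} →
  SplitBound m (suc n) → SplitBound m n → SplitBound (m + m) (suc (n + n))
splitBound-double-odd m n ih₁ ih₂ = begin
  c ((m + m) + suc (n + n))                                   ≡⟨ cong c (interchange m n) ⟩
  c (suc ((m + n) + (m + n)))                                 ≤⟨ minColless-odd-≤ (m + n) ⟩
  c (suc (m + n)) + c (m + n) + 1                             ≡⟨ cong (λ k → c k + c (m + n) + 1) (+-suc m n) ⟨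
  c (m + suc n) + c (m + n) + 1                               ≤⟨ +-monoˡ-≤ 1 (+-mono-≤ ih₁ ih₂) ⟩
  (c m + c (suc n) + ∣ m - suc n ∣) + (c m + c n + ∣ m - n ∣) + 1
    ≡⟨ rearrange (c m) (c (suc n)) (c n) ∣ m - suc n ∣ ∣ m - n ∣ ⟩
  (c m + c m) + (c (suc n) + c n + 1) + (∣ m - suc n ∣ + ∣ m - n ∣)
    ≡⟨ cong₂ _+_ (cong₂ _+_ (sym (minColless-double m)) (sym (minColless-odd n)))
                 (∣m-1+n∣+∣m-n∣≡∣m+m-1+[n+n]∣ m n) ⟩
  c (m + m) + c (suc (n + n)) + ∣ m + m - suc (n + n) ∣       ∎
  where
  open ≤-Reasoning
  c = minColless
  interchange : ∀ x y → (x + x) + suc (y + y) ≡ suc ((x + y) + (x + y))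
  interchange = solve-∀
  rearrange : ∀ a p q x y → (a + p + x) + (a + q + y) + 1 ≡ (a + a) + (p + q + 1) + (x + y)
  rearrange = solve-∀

splitBound-one-double : ∀ n → .{{NonZero n}} → SplitBound 1 n → SplitBound 1 (n + n)
splitBound-one-double n@(suc j) ih = begin
  c (suc (n + n))                ≤⟨ minColless-odd-≤ n ⟩
  c (suc n) + c n + 1            ≤⟨ +-monoˡ-≤ 1 (+-monoˡ-≤ (c n) ih) ⟩
  c n + j + c n + 1              ≡⟨ rearrange (c n) j ⟩
  (c n + c n) + suc j            ≤⟨ +-monoʳ-≤ (c n + c n) (m≤n+m (suc j) j) ⟩
  (c n + c n) + (j + suc j)      ≡⟨ cong (_+ (j + suc j)) (minColless-double n) ⟨
  c (n + n) + (j + suc j)        ∎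
  where
  open ≤-Reasoning
  c = minColless
  rearrange : ∀ x y → x + y + x + 1 ≡ (x + x) + suc y
  rearrange = solve-∀

splitBound-one-odd : ∀ n → .{{NonZero n}} → SplitBound 1 n → SplitBound 1 (suc (n + n))
splitBound-one-odd n@(suc j) ih = begin
  c (suc (suc (n + n)))          ≡⟨ cong (c ∘ suc) (+-suc n n) ⟨
  c (suc n + suc n)              ≡⟨ minColless-double (suc n) ⟩
  c (suc n) + c (suc n)          ≤⟨ +-monoʳ-≤ (c (suc n)) ih ⟩
  c (suc n) + (c n + j)          ≡⟨ +-assoc (c (suc n)) (c n) j ⟨
  c (suc n) + c n + j            ≤⟨ +-monoʳ-≤ (c (suc n) + c n) j≤1+[n+n] ⟩
  c (suc n) + c n + (1 + (n + n)) ≡⟨ +-assoc (c (suc n) + c n) 1 (n + n) ⟨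
  c (suc n) + c n + 1 + (n + n)  ≡⟨ cong (_+ (n + n)) (minColless-odd n) ⟨
  c (suc (n + n)) + (n + n)      ∎
  where
  open ≤-Reasoning
  c = minColless
  j≤1+[n+n] : j ≤ 1 + (n + n)
  j≤1+[n+n] = m≤n⇒m≤1+n (≤-trans (n≤1+n j) (m≤m+n n n))

SplitBoundBelow : ℕ → Set
SplitBoundBelow s = ∀ m n → m + n < s → SplitBound m n

splitBoundBelow-comm : ∀ m n → SplitBoundBelow (m + n) → SplitBoundBelow (n + m)
splitBoundBelow-comm m n ih x y lt = ih x y (subst (x + y <_) (+-comm n m) lt)

n<n+n : ∀ n → .{{NonZero n}} → n < n + n
n<n+n n@(suc _) = m<m+n n z<s

-- Sizes 0 and 1 are split off because minColless 1 = 0 violates the odd recurrence.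
splitBound-step : ∀ m n → SplitBoundBelow (m + n) → SplitBound m n
splitBound-step m n ih with parity m | parity n
... | even zero      | _              = splitBound-zeroˡ n
... | _              | even zero      = splitBound-sym m 0 (splitBound-zeroˡ m)
... | odd zero       | odd zero       = z≤n
... | odd zero       | even l@(suc _) =
  splitBound-one-double l (ih 1 l (s<s (n<n+n l)))
... | odd zero       | odd l@(suc _)  =
  splitBound-one-odd l (ih 1 l (s<s (m<n⇒m<1+n (n<n+n l))))
... | even k@(suc _) | odd zero       =
  splitBound-sym (k + k) 1 (splitBound-one-double k
    (splitBoundBelow-comm (k + k) 1 ih 1 k (s<s (n<n+n k))))
... | odd k@(suc _)  | odd zero       =
  splitBound-sym (suc (k + k)) 1 (splitBound-one-odd k
    (splitBoundBelow-comm (suc (k + k)) 1 ih 1 k (s<s (m<n⇒m<1+n (n<n+n k)))))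
... | even k@(suc _) | even l@(suc _) =
  splitBound-double k l (ih k l (+-mono-<-≤ (n<n+n k) (m≤m+n l l)))
... | odd k@(suc _)  | odd l@(suc _)  =
  splitBound-odd k l
    (ih (suc k) l (+-mono-<-≤ (s<s (n<n+n k)) (m≤n⇒m≤1+n (m≤m+n l l))))
    (ih k (suc l) (+-mono-<-≤ (m<n⇒m<1+n (n<n+n k)) (s≤s (m≤m+n l l))))
... | even k@(suc _) | odd l@(suc _)  =
  splitBound-double-odd k l
    (ih k (suc l) (+-mono-<-≤ (n<n+n k) (s≤s (m≤m+n l l))))
    (ih k l (+-mono-<-≤ (n<n+n k) (m≤n⇒m≤1+n (m≤m+n l l))))
... | odd k@(suc _)  | even l@(suc _) =
  splitBound-sym (suc (k + k)) (l + l) (splitBound-double-odd l k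
    (ih′ l (suc k) (+-mono-<-≤ (n<n+n l) (s≤s (m≤m+n k k))))
    (ih′ l k (+-mono-<-≤ (n<n+n l) (m≤n⇒m≤1+n (m≤m+n k k)))))
  where ih′ = splitBoundBelow-comm (suc (k + k)) (l + l) ih

splitBound : ∀ m n → SplitBound m n
splitBound m n = below (suc (m + n)) m n ≤-refl
  where
  below : ∀ s → SplitBoundBelow s
  below zero     _ _ ()
  below (suc s)  m n m+n<1+s = splitBound-step m n λ x y lt → below s x y (≤-trans lt (s≤s⁻¹ m+n<1+s))

minColless≤colless : ∀ t → minColless (leaves t) ≤ colless t
minColless≤colless leaf       = z≤n
minColless≤colless (node l r) = begin
  c (a + b)                                  ≤⟨ splitBound a b ⟩
  c a + c b + ∣ a - b ∣
    ≤⟨ +-monoˡ-≤ ∣ a - b ∣ (+-mono-≤ (minColless≤colless l) (minColless≤colless r)) ⟩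
  colless l + colless r + ∣ a - b ∣          ≡⟨ rotate (colless l) (colless r) ∣ a - b ∣ ⟩
  ∣ a - b ∣ + colless l + colless r          ≡⟨ cong (λ d → d + colless l + colless r) (absDiff≡∣-∣ a b) ⟨
  colless (node l r)                         ∎
  where
  open ≤-Reasoning
  c = minColless
  a = leaves l
  b = leaves r
  rotate : ∀ x y z → x + y + z ≡ z + x + y
  rotate = solve-∀

data IsPowerOfTwo : ℕ → Set where
  one    : IsPowerOfTwo 1
  double : ∀ {p} → IsPowerOfTwo p → IsPowerOfTwo (p + p)

powerOfTwo>0 : ∀ {p} → IsPowerOfTwo p → p > 0
powerOfTwo>0 one            = z<s
powerOfTwo>0 (double {p} q) = ≤-trans (powerOfTwo>0 q) (m≤m+n p p)

minColless-powerOfTwo : ∀ {p} → IsPowerOfTwo p → minColless p ≡ 0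
minColless-powerOfTwo one            = refl
minColless-powerOfTwo (double {p} q) =
  trans (minColless-double p) (cong₂ _+_ (minColless-powerOfTwo q) (minColless-powerOfTwo q))

powerOfTwo-<⇒double-≤ : ∀ {m n} → IsPowerOfTwo m → IsPowerOfTwo n → m < n → m + m ≤ n
powerOfTwo-<⇒double-≤ one            one            (s<s ())
powerOfTwo-<⇒double-≤ one            (double q)     _   = +-mono-≤ (powerOfTwo>0 q) (powerOfTwo>0 q)
powerOfTwo-<⇒double-≤ (double p)     one            m<1 =
  contradiction (≤-trans (+-mono-≤ (powerOfTwo>0 p) (powerOfTwo>0 p)) (s≤s⁻¹ m<1)) λ ()
powerOfTwo-<⇒double-≤ (double {m} p) (double {n} q) m<n =
  +-mono-≤ half half
  where half = powerOfTwo-<⇒double-≤ p q (1+[m+m]≤n+n⇒m<n {m} {n} m<n)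

powerOfTwo≤1+[n+n]⇒≤n+n : ∀ {q} n → .{{NonZero n}} → IsPowerOfTwo q → q ≤ suc (n + n) → q ≤ n + n
powerOfTwo≤1+[n+n]⇒≤n+n n@(suc _) one        _  = ≤-trans (s≤s z≤n) (m≤m+n n n)
powerOfTwo≤1+[n+n]⇒≤n+n n         (double {q} _) le = +-mono-≤ q≤n q≤n
  where q≤n = m+m≤1+[n+n]⇒m≤n {q} {n} le

-- For a power of two p, where minColless p = 0, this is the reverse inequality of SplitBound p r.
MergeBound : ℕ → ℕ → Set
MergeBound p r = minColless r + ∣ p - r ∣ ≤ minColless (p + r)

mergeBound-double : ∀ q s → MergeBound q s → MergeBound (q + q) (s + s)
mergeBound-double q s ih = begin
  c (s + s) + ∣ q + q - s + s ∣         ≡⟨ cong₂ _+_ (minColless-double s) (∣m+m-n+n∣≡∣m-n∣+∣m-n∣ q s) ⟩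
  (c s + c s) + (∣ q - s ∣ + ∣ q - s ∣)  ≡⟨ interchange (c s) ∣ q - s ∣ ⟩
  (c s + ∣ q - s ∣) + (c s + ∣ q - s ∣)  ≤⟨ +-mono-≤ ih ih ⟩
  c (q + s) + c (q + s)                 ≡⟨ minColless-double (q + s) ⟨
  c ((q + s) + (q + s))                 ≡⟨ cong c (interchange q s) ⟨
  c ((q + q) + (s + s))                 ∎
  where
  open ≤-Reasoning
  c = minColless
  interchange : ∀ x y → (x + x) + (y + y) ≡ (x + y) + (x + y)
  interchange = solve-∀

mergeBound-double-odd : ∀ q s → .{{NonZero s}} →
  MergeBound q (suc s) → MergeBound q s → MergeBound (q + q) (suc (s + s))
mergeBound-double-odd q s@(suc _) ih₁ ih₂ = begin
  c (suc (s + s)) + ∣ q + q - suc (s + s) ∣            ≤⟨ +-monoˡ-≤ ∣ q + q - suc (s + s) ∣ (minColless-odd-≤ s) ⟩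
  (c (suc s) + c s + 1) + ∣ q + q - suc (s + s) ∣
    ≡⟨ cong (c (suc s) + c s + 1 +_) (∣m-1+n∣+∣m-n∣≡∣m+m-1+[n+n]∣ q s) ⟨
  (c (suc s) + c s + 1) + (∣ q - suc s ∣ + ∣ q - s ∣)  ≡⟨ rearrange (c (suc s)) (c s) ∣ q - suc s ∣ ∣ q - s ∣ ⟩
  (c (suc s) + ∣ q - suc s ∣) + (c s + ∣ q - s ∣) + 1  ≤⟨ +-monoˡ-≤ 1 (+-mono-≤ ih₁ ih₂) ⟩
  c (q + suc s) + c (q + s) + 1                        ≡⟨ cong (λ k → c k + c (q + s) + 1) (+-suc q s) ⟩
  c (suc (q + s)) + c (q + s) + 1                      ≡⟨ minColless-odd (q + s) {{q+s≢0}} ⟨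
  c (suc ((q + s) + (q + s)))                          ≡⟨ cong c (interchange q s) ⟩
  c ((q + q) + suc (s + s))                            ∎
  where
  open ≤-Reasoning
  c = minColless
  q+s≢0 : NonZero (q + s)
  q+s≢0 = >-nonZero (≤-trans z<s (m≤n+m s q))
  rearrange : ∀ a b x y → (a + b + 1) + (x + y) ≡ (a + x) + (b + y) + 1
  rearrange = solve-∀
  interchange : ∀ x y → suc ((x + y) + (x + y)) ≡ (x + x) + suc (y + y)
  interchange = solve-∀

mergeBound-powerOfTwo : ∀ {p} → IsPowerOfTwo p → ∀ r → p ≤ r + r → r ≤ p + p → MergeBound p r
mergeBound-powerOfTwo one 1 _ _ = z≤n
mergeBound-powerOfTwo one 2 _ _ = s≤s z≤n
mergeBound-powerOfTwo one (suc (suc (suc _))) _ (s≤s (s≤s ()))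
mergeBound-powerOfTwo (double {q} pq) r p≤r+r r≤p+p with parity r
... | even s =
  mergeBound-double q s
    (mergeBound-powerOfTwo pq s (m+m≤n+n⇒m≤n {q} {s + s} p≤r+r) (m+m≤n+n⇒m≤n {s} {q + q} r≤p+p))
mergeBound-powerOfTwo (double one) _ _ _ | odd zero = s≤s z≤n
mergeBound-powerOfTwo (double (double {q} pq)) _ p≤r+r _ | odd zero =
  contradiction (≤-trans (powerOfTwo>0 pq) q≤0) λ ()
  where q≤0 = m+m≤1+[n+n]⇒m≤n {q} {0} (m+m≤n+n⇒m≤n {q + q} {1} p≤r+r)
... | odd s@(suc _) =
  mergeBound-double-odd q s
    (mergeBound-powerOfTwo pq (suc s) (≤-trans q≤s+s (+-mono-≤ (n≤1+n s) (n≤1+n s))) s<q+q)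
    (mergeBound-powerOfTwo pq s q≤s+s (<⇒≤ s<q+q))
  where
  q≤s+s : q ≤ s + s
  q≤s+s = powerOfTwo≤1+[n+n]⇒≤n+n s pq (m+m≤n+n⇒m≤n {q} {suc (s + s)} p≤r+r)
  s<q+q : s < q + q
  s<q+q = 1+[m+m]≤n+n⇒m<n {s} {q + q} r≤p+p

record Mergeable (m n : ℕ) : Set where
  field
    ratioˡ  : m ≤ n + n
    ratioʳ : n ≤ m + m
    powerOfTwo   : IsPowerOfTwo m ⊎ IsPowerOfTwo n

minColless-merge : ∀ {m n} → Mergeable m n → minColless m + minColless n + ∣ m - n ∣ ≤ minColless (m + n)
minColless-merge {m} {n} record { ratioˡ = m≤n+n ; ratioʳ = n≤m+m ; powerOfTwo = inj₁ pm }
  rewrite minColless-powerOfTwo pm = mergeBound-powerOfTwo pm n m≤n+n n≤m+m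
minColless-merge {m} {n} record { ratioˡ = m≤n+n ; ratioʳ = n≤m+m ; powerOfTwo = inj₂ pn }
  rewrite minColless-powerOfTwo pn | +-identityʳ (minColless m) | ∣-∣-comm m n | +-comm m n =
  mergeBound-powerOfTwo pn m n≤m+m m≤n+n

mergeable-sym : ∀ {m n} → Mergeable m n → Mergeable n m
mergeable-sym record { ratioˡ = m≤n+n ; ratioʳ = n≤m+m ; powerOfTwo = pow } =
  record { ratioˡ = n≤m+m ; ratioʳ = m≤n+n ; powerOfTwo = ⊎-swap pow }

mergeable-+ : ∀ {m n o} → m ≤ n → n ≤ o → Mergeable m o → Mergeable n o → Mergeable (m + n) o
mergeable-+ {m} {n} {o} m≤n n≤o m⋈o n⋈o = record
  { ratioˡ  = +-mono-≤ (≤-trans m≤n n≤o) n≤o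
  ; ratioʳ = ≤-trans (Mergeable.ratioʳ m⋈o) (+-mono-≤ (m≤m+n m n) (m≤m+n m n))
  ; powerOfTwo   = power (Mergeable.powerOfTwo m⋈o) (Mergeable.powerOfTwo n⋈o)
  }
  where
  -- If o is not a power of two then m and n are; either m = n, or 2m ≤ n ≤ o ≤ 2m forces n = o.
  power : IsPowerOfTwo m ⊎ IsPowerOfTwo o → IsPowerOfTwo n ⊎ IsPowerOfTwo o →
          IsPowerOfTwo (m + n) ⊎ IsPowerOfTwo o
  power (inj₂ po) _         = inj₂ po
  power _         (inj₂ po) = inj₂ po
  power (inj₁ pm) (inj₁ pn) with m≤n⇒m<n∨m≡n m≤n
  ... | inj₂ refl = inj₁ (double pm)
  ... | inj₁ m<n  = inj₂ (subst IsPowerOfTwo n≡o pn)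
    where
    n≡o : n ≡ o
    n≡o = ≤-antisym n≤o (≤-trans (Mergeable.ratioʳ m⋈o) (powerOfTwo-<⇒double-≤ pm pn m<n))

MergeableTrees : Tree → Tree → Set
MergeableTrees t u = Mergeable (leaves t) (leaves u)

record GFBInvariant (ts : List Tree) : Set where
  field
    optimal    : All (λ t → colless t ≤ minColless (leaves t)) ts
    mergeable  : AllPairs MergeableTrees ts

gfbInvariant-resp-↭ : ∀ {ts us} → ts ↭ us → GFBInvariant ts → GFBInvariant us
gfbInvariant-resp-↭ p inv = record
  { optimal   = All-resp-↭ p (GFBInvariant.optimal inv)
  ; mergeable = AllPairs-resp-↭ mergeable-sym (resp₂ MergeableTrees) (↭⇒↭ₛ p) (GFBInvariant.mergeable inv)
  }

colless-node-optimal : ∀ u v → colless u ≤ minColless (leaves u) → colless v ≤ minColless (leaves v) →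
  MergeableTrees u v → colless (node u v) ≤ minColless (leaves (node u v))
colless-node-optimal u v cu cv uv = begin
  absDiff a b + colless u + colless v             ≤⟨ +-mono-≤ (+-monoʳ-≤ (absDiff a b) cu) cv ⟩
  absDiff a b + c a + c b                         ≡⟨ cong (λ d → d + c a + c b) (absDiff≡∣-∣ a b) ⟩
  ∣ a - b ∣ + c a + c b                           ≡⟨ rotate ∣ a - b ∣ (c a) (c b) ⟩
  c a + c b + ∣ a - b ∣                           ≤⟨ minColless-merge uv ⟩
  c (a + b)                                       ∎
  where
  open ≤-Reasoning
  c = minColless
  a = leaves u
  b = leaves v
  rotate : ∀ x y z → x + y + z ≡ y + z + x
  rotate = solve-∀

gfbStep-invariant : ∀ {ts us} → GFBStep ts us → GFBInvariant ts → GFBInvariant us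
gfbStep-invariant (step u v rest p (u≤v ∷ _) v-min) inv with gfbInvariant-resp-↭ p inv
... | record { optimal = cu ∷ cv ∷ c-rest ; mergeable = (uv ∷ u-rest) ∷ v-rest ∷ rest-pairs } =
  record
  { optimal   = colless-node-optimal u v cu cv uv ∷ c-rest
  ; mergeable = All.zipWith (λ (uw , vw , v≤w) → mergeable-+ u≤v v≤w uw vw) (u-rest , All.zip (v-rest , v-min))
              ∷ rest-pairs
  }

gfbRun-optimal : ∀ {ts t} → GFBRun ts t → GFBInvariant ts → colless t ≤ minColless (leaves t)
gfbRun-optimal (done t)   inv with GFBInvariant.optimal inv
... | optimal ∷ [] = optimal
gfbRun-optimal (more s r) inv = gfbRun-optimal r (gfbStep-invariant s inv)

gfbRun-leaves : ∀ {ts t} → GFBRun ts t → leaves t ≡ sum (map leaves ts)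
gfbRun-leaves (done t) = sym (+-identityʳ (leaves t))
gfbRun-leaves (more (step u v rest p _ _) r) =
  trans (gfbRun-leaves r)
    (trans (+-assoc (leaves u) (leaves v) (sum (map leaves rest))) (sym (sum-↭ (map⁺ leaves p))))

allPairs-replicate : ∀ {A : Set} {R : A → A → Set} {x} n → R x x → AllPairs R (replicate n x)
allPairs-replicate zero    _   = []
allPairs-replicate (suc n) rxx = replicate⁺ n rxx ∷ allPairs-replicate n rxx

gfbInvariant-leaves : ∀ n → GFBInvariant (replicate n leaf)
gfbInvariant-leaves n = record
  { optimal   = replicate⁺ n z≤n
  ; mergeable = allPairs-replicate n (record { ratioˡ = s≤s z≤n ; ratioʳ = s≤s z≤n ; powerOfTwo = inj₁ one })
  }

sum-map-leaves-replicate : ∀ n → sum (map leaves (replicate n leaf)) ≡ n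
sum-map-leaves-replicate zero    = refl
sum-map-leaves-replicate (suc n) = cong suc (sum-map-leaves-replicate n)

extractMin : ∀ {A : Set} (key : A → ℕ) x xs →
  ∃₂ λ m ys → (x ∷ xs ↭ m ∷ ys) × All (λ y → key m ≤ key y) ys
extractMin key x []       = x , [] , ↭-refl , []
extractMin key x (y ∷ xs) with extractMin key y xs
... | m , ys , p , m-min with key x ≤? key m
...   | yes x≤m = x , m ∷ ys , prep x p , x≤m ∷ All.map (≤-trans x≤m) m-min
...   | no  x≰m = m , x ∷ ys , ↭-trans (prep x p) (swap x m ↭-refl) , <⇒≤ (≰⇒> x≰m) ∷ m-min

gfbRun-exists : ∀ n ts → length ts ≡ suc n → Σ Tree (GFBRun ts)
gfbRun-exists zero    (t ∷ [])  refl = t , done t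
gfbRun-exists (suc n) (t ∷ ts) len with extractMin leaves t ts
... | u , []     , p , _ = contradiction (trans (sym len) (↭-length p)) λ ()
... | u , w ∷ ws , p , u-min with extractMin leaves w ws
...   | v , rest , q , v-min =
  let t′ , run = gfbRun-exists n (node u v ∷ rest) (suc-injective (trans (sym (↭-length p′)) len)) in
  t′ , more (step u v rest p′ (All-resp-↭ q u-min) v-min) run
  where
  p′ : t ∷ ts ↭ u ∷ v ∷ rest
  p′ = ↭-trans p (prep u q)

theorem5 : (n : ℕ) → n ≥ 1 →
    Σ Tree (λ t → GFBOutput n t) ×
    ((t : Tree) → GFBOutput n t → HasMinimalColless n t)
theorem5 zero    ()
theorem5 n@(suc m) _ = gfbRun-exists m (replicate n leaf) (length-replicate n) , optimal
  where
  optimal : (t : Tree) → GFBOutput n t → HasMinimalColless n t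
  optimal t run = leaves≡n , λ t′ leaves′≡n → begin
    colless t               ≤⟨ gfbRun-optimal run (gfbInvariant-leaves n) ⟩
    minColless (leaves t)   ≡⟨ cong minColless (trans leaves≡n (sym leaves′≡n)) ⟩
    minColless (leaves t′)  ≤⟨ minColless≤colless t′ ⟩
    colless t′              ∎
    where
    open ≤-Reasoning
    leaves≡n : leaves t ≡ n
    leaves≡n = trans (gfbRun-leaves run) (sum-map-leaves-replicate n)
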